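{- Let $\mathcal{E}$ be a Boolean equation system and let $f,f',g,g'$ be proposition formulae such that $\langle\mathcal{E},f\rangle$ is bisimilar to $\langle\mathcal{E},f'\rangle$ and $\langle\mathcal{E},g\rangle$ is bisimilar to $\langle\mathcal{E},g'\rangle$. Then $\langle\mathcal{E},f\wedge g\rangle$ is bisimilar to $\langle\mathcal{E},f'\wedge g'\rangle$, and $\langle\mathcal{E},f\vee g\rangle$ is bisimilar to $\langle\mathcal{E},f'\vee g'\rangle$.
   Context: Proposition formulae: $f::=\mathsf{true}\mid\mathsf{false}\mid X\mid f\wedge f\mid f\vee f$ with $X$ a proposition variable. A Boolean equation system (BES) is a finite sequence $\mathcal{E}=(\sigma_1X_1=f_1)\cdots(\sigma_nX_n=f_n)$, $\sigma_i\in\{\mu,\nu\}$, $X_i$ pairwise distinct; $\mathsf{bnd}(\mathcal{E})=\{X_1,\dots,X_n\}$. The rank of a bound variable: $\mathsf{rank}_{(\sigma Y=f)\mathcal{E}}(X)=\mathsf{rank}_{\mathcal{E}}(X)$ if $X\neq Y$ and $=\mathsf{block}_\sigma(\mathcal{E})$ if $X=Y$, where $\mathsf{block}_\sigma(\epsilon)=0$ if $\sigma=\nu$ and $1$ if $\sigma=\mu$, and $\mathsf{block}_\sigma((\sigma'Y=f)\mathcal{E})=\mathsf{block}_\sigma(\mathcal{E})$ if $\sigma=\sigma'$ and $1+\mathsf{block}_{\sigma'}(\mathcal{E})$ otherwise. A structure graph is a tuple $\langle T,t,\to,d,r,\nearrow\rangle$: vertex set $T$, root $t\in T$, edge relation $\to\subseteq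 T\times T$, partial decoration map $d:T\to\{\blacktriangle,\blacktriangledown,\top,\bot\}$, partial rank map $r:T\to\mathbb{N}$, partial free-variable map $\nearrow:T\to\mathcal{X}$. A relation $R$ between vertices of two structure graphs is a bisimulation if for all $(u,u')\in R$: $d(u)=d'(u')$, $r(u)=r'(u')$, $\nearrow(u)=\nearrow'(u')$ (each meaning: both undefined, or both defined and equal), every edge $u\to v$ is matched by some $u'\to v'$ with $(v,v')\in R$, and vice versa. Vertices are bisimilar if some bisimulation relates them; structure graphs are bisimilar if their roots are. For a BES $\mathcal{E}$, the structure graph on vertices $\langle\mathcal{E},g\rangle$ ($g$ a formula) is defined as follows. $\langle\mathcal{E},X\rangle$ has free-variable label $X$ iff $X\notin\mathsf{bnd}(\mathcal{E})$, and rank $\mathsf{rank}_{\mathcal{E}}(X)$ iff $X\in\mathsf{bnd}(\mathcal{E})$; no other vertex has a rank or free-variable label. Decorations: $\langle\mathcal{E},\mathsf{true}\rangle$ is $\top$, $\langle\mathcal{E},\mathsf{false}\rangle$ is $\bot$, $\langle\mathcal{E},g\wedge g'\rangle$ is $\blacktriangle$, $\langle\mathcal{E},g\vee g'\rangle$ is $\blacktriangledown$; for $X\in\mathsf{bnd}(\mathcal{E})$ with equation $\sigma X=g$, $\langle\mathcal{E},X\rangle$ is $\blacktriangle$ if $g$ is a conjunction, $\blacktriangledown$ if $g$ is a disjunction, and undecorated otherwise; all other vertices are undecorated. Edges: for each operand $h$ of $g\wedge g'$, if $h$ is itself a conjunction then $\langle\mathcal{E},g\wedge g'\rangle$ has edges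 to all successors of $\langle\mathcal{E},h\rangle$, otherwise it has an edge to $\langle\mathcal{E},h\rangle$; symmetrically for $g\vee g'$ with "disjunction". For $X\in\mathsf{bnd}(\mathcal{E})$ with equation $\sigma X=g$: if $g$ is a conjunction or disjunction, $\langle\mathcal{E},X\rangle$ has edges to all successors of $\langle\mathcal{E},g\rangle$; otherwise it has a single edge to $\langle\mathcal{E},g\rangle$. Vertices for $\mathsf{true}$, $\mathsf{false}$ and free variables have no edges. $\langle\mathcal{E},f\rangle$ denotes the structure graph consisting of the vertices reachable from $\langle\mathcal{E},f\rangle$, with root $\langle\mathcal{E},f\rangle$. -}

module Defs where

open import Data.Nat using (ℕ; zero; suc; _≟_)
open import Data.Maybe using (Maybe; just; nothing)
open import Data.Product using (Σ; _×_; _,_; ∃-syntax)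
open import Data.List using (List; []; _∷_; map)
open import Relation.Nullary using (yes; no; ¬_)
open import Relation.Binary.PropositionalEquality using (_≡_)
open import Relation.Binary.Construct.Closure.ReflexiveTransitive using (Star)

Var : Set
Var = ℕ

data Formula : Set where
  tt ff : Formula
  var   : Var → Formula
  _∧_ _∨_ : Formula → Formula → Formula

infixr 6 _∧_
infixr 5 _∨_

data Fix : Set where
  μ ν : Fix

record Equation : Set where
  constructor eqn
  field
    fix : Fix
    lhs : Var
    rhs : Formula
open Equation public

-- A BES is a finite sequence of equations; pairwise distinctness of the
-- bound variables is imposed as a hypothesis (see IsBES).
BES : Set
BES = List Equation

bnd : BES → List Var
bnd = map lhs

open import Data.List.Relation.Unary.Unique.Propositional using (Unique)

IsBES : BES → Set
IsBES E = Unique (bnd E)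

lookupEq : BES → Var → Maybe Equation
lookupEq [] X = nothing
lookupEq (e ∷ E) X with X ≟ lhs e
... | yes _ = just e
... | no  _ = lookupEq E X

block : Fix → BES → ℕ
block ν [] = 0
block μ [] = 1
block μ (eqn μ _ _ ∷ E) = block μ E
block ν (eqn ν _ _ ∷ E) = block ν E
block μ (eqn ν _ _ ∷ E) = suc (block ν E)
block ν (eqn μ _ _ ∷ E) = suc (block μ E)

rank : BES → Var → Maybe ℕ
rank [] X = nothing
rank (eqn σ Y f ∷ E) X with X ≟ Y
... | yes _ = just (block σ E)
... | no  _ = rank E X

data Deco : Set where
  ▲ ▼ ⊤ ⊥ : Deco

IsConj : Formula → Set
IsConj f = Σ Formula λ a → Σ Formula λ b → f ≡ (a ∧ b)

IsDisj : Formula → Set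
IsDisj f = Σ Formula λ a → Σ Formula λ b → f ≡ (a ∨ b)

deco : BES → Formula → Maybe Deco
deco E tt = just ⊤
deco E ff = just ⊥
deco E (f ∧ g) = just ▲
deco E (f ∨ g) = just ▼
deco E (var X) with lookupEq E X
... | nothing = nothing
... | just (eqn _ _ (g ∧ h)) = just ▲
... | just (eqn _ _ (g ∨ h)) = just ▼
... | just (eqn _ _ _) = nothing

rankLabel : BES → Formula → Maybe ℕ
rankLabel E (var X) = rank E X
rankLabel E _ = nothing

freeLabel : BES → Formula → Maybe Var
freeLabel E (var X) with lookupEq E X
... | nothing = just X
... | just _  = nothing
freeLabel E _ = nothing

data Edge (E : BES) : Formula → Formula → Set where
  ∧-opˡ   : ∀ {g g'} → ¬ IsConj g → Edge E (g ∧ g') g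
  ∧-flatˡ : ∀ {g g' v} → IsConj g → Edge E g v → Edge E (g ∧ g') v
  ∧-opʳ   : ∀ {g g'} → ¬ IsConj g' → Edge E (g ∧ g') g'
  ∧-flatʳ : ∀ {g g' v} → IsConj g' → Edge E g' v → Edge E (g ∧ g') v
  ∨-opˡ   : ∀ {g g'} → ¬ IsDisj g → Edge E (g ∨ g') g
  ∨-flatˡ : ∀ {g g' v} → IsDisj g → Edge E g v → Edge E (g ∨ g') v
  ∨-opʳ   : ∀ {g g'} → ¬ IsDisj g' → Edge E (g ∨ g') g'
  ∨-flatʳ : ∀ {g g' v} → IsDisj g' → Edge E g' v → Edge E (g ∨ g') v
  var-conj : ∀ {X σ g v} → lookupEq E X ≡ just (eqn σ X g) → IsConj g →
             Edge E g v → Edge E (var X) v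
  var-disj : ∀ {X σ g v} → lookupEq E X ≡ just (eqn σ X g) → IsDisj g →
             Edge E g v → Edge E (var X) v
  var-other : ∀ {X σ g} → lookupEq E X ≡ just (eqn σ X g) → ¬ IsConj g →
              ¬ IsDisj g → Edge E (var X) g

record StructureGraph : Set₁ where
  field
    T    : Set
    t    : T
    _⇒_  : T → T → Set
    d    : T → Maybe Deco
    r    : T → Maybe ℕ
    fv   : T → Maybe Var

IsBisimulation : (G H : StructureGraph) →
  (StructureGraph.T G → StructureGraph.T H → Set) → Set
IsBisimulation G H R =
  ∀ u u' → R u u' →
    (G.d u ≡ H.d u') × (G.r u ≡ H.r u') × (G.fv u ≡ H.fv u') ×
    (∀ v → u G.⇒ v → ∃[ v' ] ((u' H.⇒ v') × R v v')) ×
    (∀ v' → u' H.⇒ v' → ∃[ v ] ((u G.⇒ v) × R v v'))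
  where
    module G = StructureGraph G
    module H = StructureGraph H

Bisimilar : StructureGraph → StructureGraph → Set₁
Bisimilar G H = Σ (StructureGraph.T G → StructureGraph.T H → Set) λ R →
  IsBisimulation G H R × R (StructureGraph.t G) (StructureGraph.t H)

-- ⟨E,f⟩ : the vertices reachable from ⟨E,f⟩, rooted at ⟨E,f⟩
⟨_,_⟩ : BES → Formula → StructureGraph
⟨ E , f ⟩ = record
  { T   = Σ Formula (Star (Edge E) f)
  ; t   = f , Star.ε
  ; _⇒_ = λ u v → Edge E (Data.Product.proj₁ u) (Data.Product.proj₁ v)
  ; d   = λ u → deco E (Data.Product.proj₁ u)
  ; r   = λ u → rankLabel E (Data.Product.proj₁ u)
  ; fv  = λ u → freeLabel E (Data.Product.proj₁ u)
  }

module Submission where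

-- Labels and edges of a vertex ⟨E,a⟩ depend only on the formula a, not on
-- the path by which it was reached.  We therefore work with bisimulations
-- on the whole structure graph of E, i.e. relations on formulae
-- ('IsBisim'), and show that they correspond exactly to bisimilarity of
-- the rooted graphs ⟨E,f⟩ ('traced-bisim', 'bisimilar-of').
--
-- The heart of the argument is a description of the edges leaving a
-- composite c(a,b) (c ∈ {∧,∨}): each is contributed by one operand, either
-- as an edge to the operand itself (if it is not c-headed) or as one of the
-- operand's own edges (if it is).  Whether a formula is c-headed is visible
-- in its labels (decoration and absence of a rank), so bisimilar operands
-- contribute matching edges ('contribution-transfer').  Hence the union of
-- bisimulations for the operands, extended by the root pair, is again a
-- bisimulation ('composite-bisim'); 'lemma3p4' applies this to c = ∧ and
-- c = ∨.

open import Defs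
open import Data.Product using (Σ; _×_; _,_; proj₁; ∃-syntax)
open import Data.Sum using (_⊎_; inj₁; inj₂)
open import Data.Nat using (_≟_)
open import Data.Maybe using (just; nothing)
open import Data.List using ([]; _∷_)
open import Function using (flip)
open import Level using (0ℓ)
open import Relation.Nullary using (¬_; yes; no)
open import Relation.Binary.Core using (Rel)
open import Relation.Binary.Construct.Union using (_∪_)
open import Relation.Binary.PropositionalEquality using (_≡_; refl; sym; trans)
open import Relation.Binary.Construct.Closure.ReflexiveTransitive using (Star; ε; _◅_; _◅◅_)

unbound-of-rank : ∀ E X → rank E X ≡ nothing → lookupEq E X ≡ nothing
unbound-of-rank [] X _ = refl
unbound-of-rank (eqn σ Y f ∷ E) X r with X ≟ Y
unbound-of-rank (eqn σ Y f ∷ E) X () | yes _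
unbound-of-rank (eqn σ Y f ∷ E) X r  | no _ = unbound-of-rank E X r

data Connective : Set where
  conj disj : Connective

combine : Connective → Formula → Formula → Formula
combine conj = _∧_
combine disj = _∨_

Headed : Connective → Formula → Set
Headed conj = IsConj
Headed disj = IsDisj

symbol : Connective → Deco
symbol conj = ▲
symbol disj = ▼

module _ (E : BES) where

  SameLabels : Formula → Formula → Set
  SameLabels a b = (deco E a ≡ deco E b) × (rankLabel E a ≡ rankLabel E b) ×
                   (freeLabel E a ≡ freeLabel E b)

  sameLabels-sym : ∀ a b → SameLabels a b → SameLabels b a
  sameLabels-sym _ _ (d , r , v) = sym d , sym r , sym v

  combine-sameLabels : ∀ c {a b a' b'} → SameLabels (combine c a b) (combine c a' b')
  combine-sameLabels conj = refl , refl , refl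
  combine-sameLabels disj = refl , refl , refl

  -- A formula is c-headed iff it is decorated with c's symbol and has no
  -- rank (a bound variable with a c-headed equation has the symbol too,
  -- but also a rank).
  headed-labels : ∀ c {a} → Headed c a → (deco E a ≡ just (symbol c)) × (rankLabel E a ≡ nothing)
  headed-labels conj (_ , _ , refl) = refl , refl
  headed-labels disj (_ , _ , refl) = refl , refl

  labels-headed : ∀ c a → deco E a ≡ just (symbol c) → rankLabel E a ≡ nothing → Headed c a
  labels-headed conj (a ∧ b) _ _ = a , b , refl
  labels-headed disj (a ∨ b) _ _ = a , b , refl
  labels-headed conj tt () _
  labels-headed disj tt () _
  labels-headed conj ff () _
  labels-headed disj ff () _
  labels-headed conj (a ∨ b) () _
  labels-headed disj (a ∧ b) () _
  labels-headed c (var X) d r with lookupEq E X | unbound-of-rank E X r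
  labels-headed conj (var X) () r | .nothing | refl
  labels-headed disj (var X) () r | .nothing | refl

  headed-transfer : ∀ c {a b} → SameLabels a b → Headed c a → Headed c b
  headed-transfer c {a} {b} (d , r , _) h =
    let (da , ra) = headed-labels c h
    in labels-headed c b (trans (sym d) da) (trans (sym r) ra)

  Matches : Rel Formula 0ℓ → Formula → Formula → Set
  Matches S a b = ∀ v → Edge E a v → ∃[ v' ] (Edge E b v' × S v v')

  matches-mono : ∀ {S T : Rel Formula 0ℓ} → (∀ {x y} → S x y → T x y) →
                 ∀ {a b} → Matches S a b → Matches T a b
  matches-mono S⊆T m v e = let (v' , e' , s) = m v e in v' , e' , S⊆T s

  IsBisim : Rel Formula 0ℓ → Set
  IsBisim S = ∀ a b → S a b → SameLabels a b × Matches S a b × Matches (flip S) b a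

  converse-bisim : ∀ {S} → IsBisim S → IsBisim (flip S)
  converse-bisim B a b s = let (l , fw , bw) = B b a s in sameLabels-sym b a l , bw , fw

  union-bisim : ∀ {S T} → IsBisim S → IsBisim T → IsBisim (S ∪ T)
  union-bisim B₁ B₂ a b (inj₁ s) =
    let (l , fw , bw) = B₁ a b s in l , matches-mono inj₁ fw , matches-mono inj₁ bw
  union-bisim B₁ B₂ a b (inj₂ t) =
    let (l , fw , bw) = B₂ a b t in l , matches-mono inj₂ fw , matches-mono inj₂ bw

  data WithRoot (S : Rel Formula 0ℓ) (c c' : Formula) : Formula → Formula → Set where
    root  : WithRoot S c c' c c'
    below : ∀ {x y} → S x y → WithRoot S c c' x y

  with-root-bisim : ∀ {S c c'} → IsBisim S →
                    SameLabels c c' → Matches S c c' → Matches (flip S) c' c →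
                    IsBisim (WithRoot S c c')
  with-root-bisim B l fw bw _ _ root = l , matches-mono below fw , matches-mono below bw
  with-root-bisim B l fw bw a b (below s) =
    let (l' , fw' , bw') = B a b s in l' , matches-mono below fw' , matches-mono below bw'

  -- The edges of combine c a b contributed by the operand a.
  data Contribution (c : Connective) (a : Formula) : Formula → Set where
    operand   : ¬ Headed c a → Contribution c a a
    inherited : ∀ {v} → Headed c a → Edge E a v → Contribution c a v

  edge-split : ∀ c {a b v} → Edge E (combine c a b) v → Contribution c a v ⊎ Contribution c b v
  edge-split conj (∧-opˡ n)     = inj₁ (operand n)
  edge-split conj (∧-flatˡ h e) = inj₁ (inherited h e)
  edge-split conj (∧-opʳ n)     = inj₂ (operand n)
  edge-split conj (∧-flatʳ h e) = inj₂ (inherited h e)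
  edge-split disj (∨-opˡ n)     = inj₁ (operand n)
  edge-split disj (∨-flatˡ h e) = inj₁ (inherited h e)
  edge-split disj (∨-opʳ n)     = inj₂ (operand n)
  edge-split disj (∨-flatʳ h e) = inj₂ (inherited h e)

  edge-join : ∀ c {a b v} → Contribution c a v ⊎ Contribution c b v → Edge E (combine c a b) v
  edge-join conj (inj₁ (operand n))     = ∧-opˡ n
  edge-join conj (inj₁ (inherited h e)) = ∧-flatˡ h e
  edge-join conj (inj₂ (operand n))     = ∧-opʳ n
  edge-join conj (inj₂ (inherited h e)) = ∧-flatʳ h e
  edge-join disj (inj₁ (operand n))     = ∨-opˡ n
  edge-join disj (inj₁ (inherited h e)) = ∨-flatˡ h e
  edge-join disj (inj₂ (operand n))     = ∨-opʳ n
  edge-join disj (inj₂ (inherited h e)) = ∨-flatʳ h e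

  contribution-transfer : ∀ c {S a a' v} → IsBisim S → S a a' → Contribution c a v →
                          ∃[ v' ] (Contribution c a' v' × S v v')
  contribution-transfer c {a = a} {a'} B s (operand n) =
    let (l , _ , _) = B _ _ s
    in a' , operand (λ h → n (headed-transfer c (sameLabels-sym a a' l) h)) , s
  contribution-transfer c B s (inherited h e) =
    let (l , fw , _) = B _ _ s
        (v' , e' , s') = fw _ e
    in v' , inherited (headed-transfer c l h) e' , s'

  combine-matches : ∀ c {S T a a' b b'} → IsBisim S → IsBisim T → S a a' → T b b' →
                    Matches (S ∪ T) (combine c a b) (combine c a' b')
  combine-matches c B₁ B₂ s t v e with edge-split c e
  ... | inj₁ k = let (v' , k' , s') = contribution-transfer c B₁ s k in v' , edge-join c (inj₁ k') , inj₁ s'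
  ... | inj₂ k = let (v' , k' , t') = contribution-transfer c B₂ t k in v' , edge-join c (inj₂ k') , inj₂ t'

  composite-bisim : ∀ c {S T a a' b b'} → IsBisim S → IsBisim T → S a a' → T b b' →
                    IsBisim (WithRoot (S ∪ T) (combine c a b) (combine c a' b'))
  composite-bisim c B₁ B₂ s t =
    with-root-bisim (union-bisim B₁ B₂) (combine-sameLabels c)
      (combine-matches c B₁ B₂ s t)
      (combine-matches c (converse-bisim B₁) (converse-bisim B₂) s t)

  Traced : ∀ {f f'} → (Σ Formula (Star (Edge E) f) → Σ Formula (Star (Edge E) f') → Set) →
           Rel Formula 0ℓ
  Traced {f} {f'} R a b = Σ (Star (Edge E) f a) λ p → Σ (Star (Edge E) f' b) λ p' → R (a , p) (b , p')

  traced-bisim : ∀ {f f' R} → IsBisimulation ⟨ E , f ⟩ ⟨ E , f' ⟩ R → IsBisim (Traced R)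
  traced-bisim B a b (p , p' , r) =
    let (d , rk , fv , fw , bw) = B (a , p) (b , p') r
    in (d , rk , fv)
     , (λ v e → let ((v' , q') , e' , r') = fw (v , p ◅◅ e ◅ ε) e in v' , e' , (_ , q' , r'))
     , (λ v' e' → let ((v , q) , e , r') = bw (v' , p' ◅◅ e' ◅ ε) e' in v , e , (q , _ , r'))

  bisimilar-of : ∀ {S f f'} → IsBisim S → S f f' → Bisimilar ⟨ E , f ⟩ ⟨ E , f' ⟩
  bisimilar-of {S} {f} {f'} B s = (λ u u' → S (proj₁ u) (proj₁ u')) , bisim , s
    where
    bisim : IsBisimulation ⟨ E , f ⟩ ⟨ E , f' ⟩ (λ u u' → S (proj₁ u) (proj₁ u'))
    bisim (a , p) (b , p') s =
      let ((d , rk , fv) , fw , bw) = B a b s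
      in d , rk , fv
       , (λ (v , _) e → let (v' , e' , s') = fw v e in (v' , p' ◅◅ e' ◅ ε) , e' , s')
       , (λ (v' , _) e' → let (v , e , s') = bw v' e' in (v , p ◅◅ e ◅ ε) , e , s')

  bisimilar-combine : ∀ c {f f' g g'} → Bisimilar ⟨ E , f ⟩ ⟨ E , f' ⟩ → Bisimilar ⟨ E , g ⟩ ⟨ E , g' ⟩ →
                      Bisimilar ⟨ E , combine c f g ⟩ ⟨ E , combine c f' g' ⟩
  bisimilar-combine c (R₁ , B₁ , r₁) (R₂ , B₂ , r₂) =
    bisimilar-of (composite-bisim c (traced-bisim B₁) (traced-bisim B₂) (ε , ε , r₁) (ε , ε , r₂)) root

-- Lemma 3.4.
lemma3p4 : (E : BES) → IsBES E → (f f' g g' : Formula) →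
    Bisimilar ⟨ E , f ⟩ ⟨ E , f' ⟩ → Bisimilar ⟨ E , g ⟩ ⟨ E , g' ⟩ →
    Bisimilar ⟨ E , f ∧ g ⟩ ⟨ E , f' ∧ g' ⟩ × Bisimilar ⟨ E , f ∨ g ⟩ ⟨ E , f' ∨ g' ⟩
lemma3p4 E _ f f' g g' bf bg = bisimilar-combine E conj bf bg , bisimilar-combine E disj bf bg
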